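{- Let $L$ be a complete lattice and $u\colon L\to L$ monotone, and define $\bar{u}\colon L\to L$ by $\bar{u}(x)=\mu(\hat{u}_x)$ where $\hat{u}_x(y)=u(y)\sqcup x$. Then: (1) $\bar{u}$ is the least closure larger than $u$, i.e. $\bar u$ is monotone, extensive and idempotent, $u\sqsubseteq\bar u$ pointwise, and $\bar u\sqsubseteq v$ for every closure $v$ on $L$ with $u\sqsubseteq v$; (2) for any monotone $f\colon L\to L$, if $u$ is $f$-compatible then $\bar{u}$ is $f$-compatible; (3) if $u$ is continuous and strict then $\bar{u}$ is continuous and strict.
   Context: A closure on $L$ is a monotone, extensive ($l\sqsubseteq c(l)$) and idempotent ($c\circ c=c$) function. A monotone $u$ is $f$-compatible if $u\circ f\sqsubseteq f\circ u$ pointwise. $\mu g$ is the least fixpoint of the monotone function $g$. Continuous = preserves joins of directed sets; strict = maps $\bot$ to $\bot$. -}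

module Defs where

open import Level using (Level; _⊔_; suc; Lift)
open import Data.Product using (Σ; ∃; _×_; _,_)
open import Data.Sum using (_⊎_)
open import Data.Empty using (⊥)
open import Relation.Unary using (Pred)
open import Relation.Binary.Bundles using (Poset)

record CompleteLattice (c ℓ₁ ℓ₂ : Level) : Set (suc (c ⊔ ℓ₁ ⊔ ℓ₂)) where
  field
    poset : Poset c ℓ₁ ℓ₂
  open Poset poset public
  field
    ⋁ : Pred Carrier (c ⊔ ℓ₁ ⊔ ℓ₂) → Carrier
    ⋁-upper : ∀ (S : Pred Carrier (c ⊔ ℓ₁ ⊔ ℓ₂)) x → S x → x ≤ ⋁ S
    ⋁-least : ∀ (S : Pred Carrier (c ⊔ ℓ₁ ⊔ ℓ₂)) y →
              (∀ x → S x → x ≤ y) → ⋁ S ≤ y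
    ⋀ : Pred Carrier (c ⊔ ℓ₁ ⊔ ℓ₂) → Carrier
    ⋀-lower : ∀ (S : Pred Carrier (c ⊔ ℓ₁ ⊔ ℓ₂)) x → S x → ⋀ S ≤ x
    ⋀-greatest : ∀ (S : Pred Carrier (c ⊔ ℓ₁ ⊔ ℓ₂)) y →
                 (∀ x → S x → y ≤ x) → y ≤ ⋀ S

  _∨_ : Carrier → Carrier → Carrier
  x ∨ y = ⋁ (λ z → Lift (c ⊔ ℓ₁ ⊔ ℓ₂) ((z ≈ x) ⊎ (z ≈ y)))

  ⊥L : Carrier
  ⊥L = ⋁ (λ _ → Lift (c ⊔ ℓ₁ ⊔ ℓ₂) ⊥)

  Monotone : (Carrier → Carrier) → Set (c ⊔ ℓ₂)
  Monotone f = ∀ {x y} → x ≤ y → f x ≤ f y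

  _⊑_ : (Carrier → Carrier) → (Carrier → Carrier) → Set (c ⊔ ℓ₂)
  f ⊑ g = ∀ x → f x ≤ g x

  Extensive : (Carrier → Carrier) → Set (c ⊔ ℓ₂)
  Extensive f = ∀ x → x ≤ f x

  Idempotent : (Carrier → Carrier) → Set (c ⊔ ℓ₁)
  Idempotent f = ∀ x → f (f x) ≈ f x

  IsClosure : (Carrier → Carrier) → Set (c ⊔ ℓ₁ ⊔ ℓ₂)
  IsClosure f = Monotone f × Extensive f × Idempotent f

  Compatible : (f u : Carrier → Carrier) → Set (c ⊔ ℓ₂)
  Compatible f u = (λ x → u (f x)) ⊑ (λ x → f (u x))

  -- least fixpoint of a monotone function, via Knaster–Tarski:
  -- the meet of all pre-fixpoints
  μ : (Carrier → Carrier) → Carrier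
  μ g = ⋀ (λ y → Lift (c ⊔ ℓ₁ ⊔ ℓ₂) (g y ≤ y))

  Directed : Pred Carrier (c ⊔ ℓ₁ ⊔ ℓ₂) → Set (c ⊔ ℓ₁ ⊔ ℓ₂)
  Directed D = (∃ λ x → D x) ×
               (∀ x y → D x → D y → ∃ λ z → D z × x ≤ z × y ≤ z)

  Image : (Carrier → Carrier) → Pred Carrier (c ⊔ ℓ₁ ⊔ ℓ₂) →
          Pred Carrier (c ⊔ ℓ₁ ⊔ ℓ₂)
  Image f D y = ∃ λ x → D x × (y ≈ f x)

  Continuous : (Carrier → Carrier) → Set (suc (c ⊔ ℓ₁ ⊔ ℓ₂))
  Continuous f = ∀ (D : Pred Carrier (c ⊔ ℓ₁ ⊔ ℓ₂)) → Directed D →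
                 f (⋁ D) ≈ ⋁ (Image f D)

  Strict : (Carrier → Carrier) → Set ℓ₁
  Strict f = f ⊥L ≈ ⊥L

  ubar : (Carrier → Carrier) → Carrier → Carrier
  ubar u x = μ (λ y → u y ∨ x)

-- ū x is the least u-closed element above x (Knaster–Tarski for y ↦ u y ⊔ x).
-- All three parts follow from this universal property: a candidate bound w
-- dominates ū x as soon as w is u-closed and above x. For continuity the
-- candidate is ⋁ ū[D], which is u-closed because u commutes with the
-- directed join ū[D] and each ū d is u-closed.
module Submission where

open import Defs
open import Level using (Level; lift)
open import Data.Product using (_×_; _,_; proj₁; proj₂)
open import Data.Sum using (inj₁; inj₂)

module CompleteLatticeProperties {c ℓ₁ ℓ₂ : Level} (L : CompleteLattice c ℓ₁ ℓ₂) where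
  open CompleteLattice L

  x≤x∨y : ∀ x y → x ≤ x ∨ y
  x≤x∨y x y = ⋁-upper _ x (lift (inj₁ Eq.refl))

  y≤x∨y : ∀ x y → y ≤ x ∨ y
  y≤x∨y x y = ⋁-upper _ y (lift (inj₂ Eq.refl))

  ∨-least : ∀ {x y z} → x ≤ z → y ≤ z → x ∨ y ≤ z
  ∨-least x≤z y≤z = ⋁-least _ _ λ
    { _ (lift (inj₁ w≈x)) → trans (reflexive w≈x) x≤z
    ; _ (lift (inj₂ w≈y)) → trans (reflexive w≈y) y≤z
    }

  ⊥L-minimum : ∀ x → ⊥L ≤ x
  ⊥L-minimum x = ⋁-least _ x λ _ ()

  f[x]≤⋁Image : ∀ f {D} {x} → D x → f x ≤ ⋁ (Image f D)
  f[x]≤⋁Image f Dx = ⋁-upper _ _ (_ , Dx , Eq.refl)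

  ⋁Image-least : ∀ f D {y} → (∀ x → D x → f x ≤ y) → ⋁ (Image f D) ≤ y
  ⋁Image-least f D f≤y = ⋁-least _ _ λ { _ (x , Dx , w≈fx) → trans (reflexive w≈fx) (f≤y x Dx) }

  Image-directed : ∀ {f} D → Monotone f → Directed D → Directed (Image f D)
  Image-directed {f} D f-mono ((d , Dd) , bound) =
    (f d , d , Dd , Eq.refl) , λ
      { _ _ (x , Dx , y≈fx) (x′ , Dx′ , y′≈fx′) →
          let (z , Dz , x≤z , x′≤z) = bound x x′ Dx Dx′ in
          f z , (z , Dz , Eq.refl)
              , trans (reflexive y≈fx) (f-mono x≤z)
              , trans (reflexive y′≈fx′) (f-mono x′≤z)
      }

  μ-least : ∀ g {y} → g y ≤ y → μ g ≤ y
  μ-least g gy≤y = ⋀-lower _ _ (lift gy≤y)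

  μ-prefixed : ∀ {g} → Monotone g → g (μ g) ≤ μ g
  μ-prefixed {g} g-mono = ⋀-greatest _ _ λ y (lift gy≤y) →
    trans (g-mono (μ-least g gy≤y)) gy≤y

  module ClosureOf (u : Carrier → Carrier) (u-mono : Monotone u) where

    ubar-least : ∀ {x y} → u y ≤ y → x ≤ y → ubar u x ≤ y
    ubar-least uy≤y x≤y = μ-least _ (∨-least uy≤y x≤y)

    ubar-prefixed : ∀ x → u (ubar u x) ∨ x ≤ ubar u x
    ubar-prefixed x = μ-prefixed λ y≤y′ → ∨-least
      (trans (u-mono y≤y′) (x≤x∨y _ _)) (y≤x∨y _ _)

    ubar-closed : ∀ x → u (ubar u x) ≤ ubar u x
    ubar-closed x = trans (x≤x∨y _ _) (ubar-prefixed x)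

    ubar-extensive : Extensive (ubar u)
    ubar-extensive x = trans (y≤x∨y _ _) (ubar-prefixed x)

    ubar-monotone : Monotone (ubar u)
    ubar-monotone x≤y = ubar-least (ubar-closed _) (trans x≤y (ubar-extensive _))

    ubar-idempotent : Idempotent (ubar u)
    ubar-idempotent x = antisym (ubar-least (ubar-closed x) refl) (ubar-extensive _)

    ubar-isClosure : IsClosure (ubar u)
    ubar-isClosure = ubar-monotone , ubar-extensive , ubar-idempotent

    u⊑ubar : u ⊑ ubar u
    u⊑ubar x = trans (u-mono (ubar-extensive x)) (ubar-closed x)

    ubar-leastClosure : ∀ v → IsClosure v → u ⊑ v → ubar u ⊑ v
    ubar-leastClosure v (_ , v-extensive , v-idempotent) u⊑v x =
      ubar-least (trans (u⊑v (v x)) (reflexive (v-idempotent x))) (v-extensive x)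

    ubar-compatible : ∀ f → Monotone f → Compatible f u → Compatible f (ubar u)
    ubar-compatible f f-mono u-compat x =
      ubar-least (trans (u-compat _) (f-mono (ubar-closed x))) (f-mono (ubar-extensive x))

    ubar-continuous : Continuous u → Continuous (ubar u)
    ubar-continuous u-cont D D-directed =
      antisym (ubar-least ⋁ubar[D]-closed ⋁D≤⋁ubar[D])
              (⋁Image-least _ D λ d Dd → ubar-monotone (⋁-upper D d Dd))
      where
      ⋁ubar[D] : Carrier
      ⋁ubar[D] = ⋁ (Image (ubar u) D)

      ⋁ubar[D]-closed : u ⋁ubar[D] ≤ ⋁ubar[D]
      ⋁ubar[D]-closed = begin
        u ⋁ubar[D]                             ≈⟨ u-cont _ (Image-directed D ubar-monotone D-directed) ⟩
        ⋁ (Image u (Image (ubar u) D))         ≤⟨ ⋁Image-least u _ (λ { _ (d , Dd , y≈ubar[d]) →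
                                                    trans (u-mono (reflexive y≈ubar[d]))
                                                          (trans (ubar-closed d) (f[x]≤⋁Image (ubar u) Dd)) }) ⟩
        ⋁ubar[D]                               ∎
        where open import Relation.Binary.Reasoning.PartialOrder poset

      ⋁D≤⋁ubar[D] : ⋁ D ≤ ⋁ubar[D]
      ⋁D≤⋁ubar[D] = ⋁-least _ _ λ d Dd → trans (ubar-extensive d) (f[x]≤⋁Image (ubar u) Dd)

    ubar-strict : Strict u → Strict (ubar u)
    ubar-strict u-strict =
      antisym (ubar-least (reflexive u-strict) refl) (⊥L-minimum _)

lemma5p5 : ∀ {c ℓ₁ ℓ₂ : Level} (L : CompleteLattice c ℓ₁ ℓ₂) →
    let open CompleteLattice L in
    (u : Carrier → Carrier) → Monotone u →
    ((IsClosure (ubar u) × u ⊑ ubar u ×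
       (∀ (v : Carrier → Carrier) → IsClosure v → u ⊑ v → ubar u ⊑ v))
    × (∀ (f : Carrier → Carrier) → Monotone f →
         Compatible f u → Compatible f (ubar u))
    × (Continuous u → Strict u → Continuous (ubar u) × Strict (ubar u)))
lemma5p5 L u u-mono =
  (ubar-isClosure , u⊑ubar , ubar-leastClosure) ,
  ubar-compatible ,
  λ u-cont u-strict → ubar-continuous u-cont , ubar-strict u-strict
  where open CompleteLatticeProperties.ClosureOf L u u-mono
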